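{- Let $A_4=\{n\in\mathbb{Z}: 0<n<9999,\ n\neq 1111\,s \text{ for } s=0,1,\dots,9\}$, each element written with exactly four decimal digits (padding with leading zeros), and let $K:A_4\to A_4$ be the Kaprekar map: $K(n)=X-Y$, where $X$ is the four-digit number obtained by arranging the digits of $n$ in descending order and $Y$ is obtained by arranging them in ascending order. Let $B_4=\{K(n): n\in A_4\}$. Then a number $n$ with four-digit representation $(a\,b\,c\,d)$ (digits $a,b,c,d\in\{0,\dots,9\}$) belongs to $B_4$ if and only if one of the following holds: (1) $a+d=10$, $b+c=8$ and $a\geq b+1$; (2) $b=c=9$, $a+d=9$ and $a\leq 8$.
   Context: Here $(a\,b\,c\,d)$ denotes the number $a\cdot 10^3+b\cdot 10^2+c\cdot 10+d$. -}

module Defs where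

open import Data.Nat using (ℕ; zero; suc; _+_; _*_; _∸_; _<_; _≤_; _≤ᵇ_)
open import Data.Nat.DivMod using (_/_; _%_)
open import Data.Bool using (if_then_else_)
open import Data.List using (List; []; _∷_; reverse)
open import Data.Product using (Σ; _×_; ∃-syntax)
open import Relation.Binary.PropositionalEquality using (_≡_)
open import Relation.Nullary using (¬_)

digits4 : ℕ → List ℕ
digits4 n = (n / 1000) % 10 ∷ (n / 100) % 10 ∷ (n / 10) % 10 ∷ n % 10 ∷ []

insert : ℕ → List ℕ → List ℕ
insert x [] = x ∷ []
insert x (y ∷ ys) = if x ≤ᵇ y then x ∷ y ∷ ys else y ∷ insert x ys

sortAsc : List ℕ → List ℕ
sortAsc [] = []
sortAsc (x ∷ xs) = insert x (sortAsc xs)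

fromDigits : List ℕ → ℕ
fromDigits = go 0
  where
  go : ℕ → List ℕ → ℕ
  go acc [] = acc
  go acc (x ∷ xs) = go (acc * 10 + x) xs

descNum : ℕ → ℕ
descNum n = fromDigits (reverse (sortAsc (digits4 n)))

ascNum : ℕ → ℕ
ascNum n = fromDigits (sortAsc (digits4 n))

-- Kaprekar map K(n) = X - Y (X ≥ Y always, so truncated subtraction is exact)
K : ℕ → ℕ
K n = descNum n ∸ ascNum n

A4 : ℕ → Set
A4 n = (0 < n) × (n < 9999) × ((s : ℕ) → s ≤ 9 → ¬ (n ≡ 1111 * s))

B4 : ℕ → Set
B4 n = ∃[ m ] (A4 m × K m ≡ n)

{-# OPTIONS --safe #-}
-- K(n) depends only on the sorted digits x ≥ y ≥ z ≥ w of n: K(n) = 999 p + 90 q with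
-- p = x − w ∈ [1, 9] (n is not a repdigit) and q = y − z ∈ [0, p]. For q ≥ 1 the digits
-- of 999 p + 90 q are (p, q − 1, 9 − q, 10 − p), which is family (1); for q = 0 they are
-- (p − 1, 9, 9, 10 − p), family (2). Accordingly (a, b + 1, 0, 0) and (a + 1, 0, 0, 0)
-- are preimages of the two families; the inclusion of B₄ in them is a finite check.
module Submission where

open import Defs
open import Data.Nat using (ℕ; NonZero; suc; _+_; _*_; _∸_; _<_; _≤_; s≤s; _≟_; _<?_; _≤?_)
open import Data.Nat.Properties using (allUpTo?; m+n∸m≡n; +-comm; +-identityʳ; ≤-pred)
open import Data.Nat.DivMod using (_/_; _%_; +-distrib-/-∣ˡ; m*n/n≡m; m<n⇒m/n≡0;
  [m+kn]%n≡m%n; m<n⇒m%n≡m; m/n/o≡m/[n*o])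
open import Data.Nat.Divisibility using (divides-refl)
open import Data.Nat.Tactic.RingSolver using (solve-∀)
open import Data.Empty using (⊥)
open import Data.List using (List; []; _∷_)
open import Data.Product using (_×_; _,_)
open import Data.Sum using (_⊎_; inj₁; inj₂)
open import Function.Bundles using (_⇔_; mk⇔)
open import Relation.Nullary using (Dec; no; ¬_; ¬?)
open import Relation.Nullary.Decidable using (True; toWitness; map′; _×-dec_; _⊎-dec_; _→-dec_)
open import Relation.Unary using (Decidable)
open import Relation.Binary.PropositionalEquality using (_≡_; refl; sym; trans; cong; cong₂; subst)
open Relation.Binary.PropositionalEquality.≡-Reasoning

decimal : ℕ → ℕ → ℕ → ℕ → ℕ
decimal a b c d = a * 1000 + b * 100 + c * 10 + d

decimal-horner : ∀ a b c d → a * 1000 + b * 100 + c * 10 + d ≡ ((a * 10 + b) * 10 + c) * 10 + d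
decimal-horner = solve-∀

[m*n+o]/n≡m : ∀ m n {o} .{{_ : NonZero n}} → o < n → (m * n + o) / n ≡ m
[m*n+o]/n≡m m n {o} o<n = begin
  (m * n + o) / n         ≡⟨ +-distrib-/-∣ˡ o (divides-refl m) ⟩
  m * n / n + o / n       ≡⟨ cong₂ _+_ (m*n/n≡m m n) (m<n⇒m/n≡0 o<n) ⟩
  m + 0                   ≡⟨ +-identityʳ m ⟩
  m                       ∎

[m*n+o]%n≡o : ∀ m n {o} .{{_ : NonZero n}} → o < n → (m * n + o) % n ≡ o
[m*n+o]%n≡o m n {o} o<n = begin
  (m * n + o) % n         ≡⟨ cong (_% n) (+-comm (m * n) o) ⟩
  (o + m * n) % n         ≡⟨ [m+kn]%n≡m%n o m n ⟩
  o % n                   ≡⟨ m<n⇒m%n≡m o<n ⟩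
  o                       ∎

digits4-horner : ∀ {a b c d} → a < 10 → b < 10 → c < 10 → d < 10 →
  digits4 (((a * 10 + b) * 10 + c) * 10 + d) ≡ a ∷ b ∷ c ∷ d ∷ []
digits4-horner {a} {b} {c} {d} a<10 b<10 c<10 d<10 =
  cong₂ _∷_ (trans (cong (_% 10) n/1000≡a) (m<n⇒m%n≡m a<10))
  (cong₂ _∷_ (trans (cong (_% 10) n/100≡ab) ([m*n+o]%n≡o a 10 b<10))
  (cong₂ _∷_ (trans (cong (_% 10) n/10≡abc) ([m*n+o]%n≡o ab 10 c<10))
  (cong₂ _∷_ ([m*n+o]%n≡o abc 10 d<10) refl)))
  where
  ab : ℕ
  ab = a * 10 + b
  abc : ℕ
  abc = ab * 10 + c
  n : ℕ
  n = abc * 10 + d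
  n/10≡abc : n / 10 ≡ abc
  n/10≡abc = [m*n+o]/n≡m abc 10 d<10
  n/100≡ab : n / 100 ≡ ab
  n/100≡ab = begin
    n / 100        ≡⟨ m/n/o≡m/[n*o] n 10 10 ⟨
    n / 10 / 10    ≡⟨ cong (_/ 10) n/10≡abc ⟩
    abc / 10       ≡⟨ [m*n+o]/n≡m ab 10 c<10 ⟩
    ab             ∎
  n/1000≡a : n / 1000 ≡ a
  n/1000≡a = begin
    n / 1000       ≡⟨ m/n/o≡m/[n*o] n 100 10 ⟨
    n / 100 / 10   ≡⟨ cong (_/ 10) n/100≡ab ⟩
    ab / 10        ≡⟨ [m*n+o]/n≡m a 10 b<10 ⟩
    a              ∎

digits4-decimal : ∀ {a b c d} → a < 10 → b < 10 → c < 10 → d < 10 →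
  digits4 (decimal a b c d) ≡ a ∷ b ∷ c ∷ d ∷ []
digits4-decimal {a} {b} {c} {d} a<10 b<10 c<10 d<10 =
  trans (cong digits4 (decimal-horner a b c d)) (digits4-horner a<10 b<10 c<10 d<10)

KaprekarDigits : ℕ → ℕ → ℕ → ℕ → Set
KaprekarDigits a b c d =
  (a + d ≡ 10 × b + c ≡ 8 × b + 1 ≤ a) ⊎ (b ≡ 9 × c ≡ 9 × a + d ≡ 9 × a ≤ 8)

kaprekarDigits? : ∀ a b c d → Dec (KaprekarDigits a b c d)
kaprekarDigits? a b c d =
  (a + d ≟ 10 ×-dec b + c ≟ 8 ×-dec b + 1 ≤? a)
  ⊎-dec (b ≟ 9 ×-dec c ≟ 9 ×-dec a + d ≟ 9 ×-dec a ≤? 8)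

KaprekarDigitList : List ℕ → Set
KaprekarDigitList (a ∷ b ∷ c ∷ d ∷ []) = KaprekarDigits a b c d
KaprekarDigitList _ = ⊥

kaprekarDigitList? : Decidable KaprekarDigitList
kaprekarDigitList? (a ∷ b ∷ c ∷ d ∷ []) = kaprekarDigits? a b c d
kaprekarDigitList? [] = no λ ()
kaprekarDigitList? (_ ∷ []) = no λ ()
kaprekarDigitList? (_ ∷ _ ∷ []) = no λ ()
kaprekarDigitList? (_ ∷ _ ∷ _ ∷ []) = no λ ()
kaprekarDigitList? (_ ∷ _ ∷ _ ∷ _ ∷ _ ∷ _) = no λ ()

A4? : Decidable A4
A4? m = 0 <? m ×-dec m <? 9999 ×-dec map′ ≤9⇒ <10⇒ (allUpTo? (λ s → ¬? (m ≟ 1111 * s)) 10)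
  where
  NotRepdigit : Set
  NotRepdigit = (s : ℕ) → s ≤ 9 → ¬ m ≡ 1111 * s
  ≤9⇒ : (∀ {s} → s < 10 → ¬ m ≡ 1111 * s) → NotRepdigit
  ≤9⇒ h s s≤9 = h (s≤s s≤9)
  <10⇒ : NotRepdigit → ∀ {s} → s < 10 → ¬ m ≡ 1111 * s
  <10⇒ h {s} s<10 = h s (≤-pred s<10)

module _ {p} {P : ℕ → Set p} (P? : Decidable P) where

  allBelow : ∀ n → {True (allUpTo? P? n)} → ∀ {m} → m < n → P m
  allBelow n {holds} = toWitness holds

kaprekarDigits-K : ∀ m → A4 m → KaprekarDigitList (digits4 (K m))
kaprekarDigits-K m a4@(_ , m<9999 , _) = allBelow
  (λ n → A4? n →-dec kaprekarDigitList? (digits4 (K n))) 9999 m<9999 a4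

B4-witness₁ : ∀ {a b} → a < 10 → b < a →
  A4 (decimal a (suc b) 0 0) × K (decimal a (suc b) 0 0) ≡ decimal a b (8 ∸ b) (10 ∸ a)
B4-witness₁ a<10 = allBelow (λ a → allUpTo? (λ b →
    A4? (decimal a (suc b) 0 0) ×-dec K (decimal a (suc b) 0 0) ≟ decimal a b (8 ∸ b) (10 ∸ a)) a)
  10 a<10

B4-witness₂ : ∀ {a} → a < 9 →
  A4 (decimal (suc a) 0 0 0) × K (decimal (suc a) 0 0 0) ≡ decimal a 9 9 (9 ∸ a)
B4-witness₂ = allBelow (λ a →
    A4? (decimal (suc a) 0 0 0) ×-dec K (decimal (suc a) 0 0 0) ≟ decimal a 9 9 (9 ∸ a))
  9

+≡⇒≡∸ : ∀ m n {o} → m + n ≡ o → n ≡ o ∸ m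
+≡⇒≡∸ m n refl = sym (m+n∸m≡n m n)

B4-family₁ : ∀ {a b c d} → a < 10 → b + 1 ≤ a → a + d ≡ 10 → b + c ≡ 8 →
  B4 (decimal a b c d)
B4-family₁ {a} {b} {c} {d} a<10 b+1≤a a+d≡10 b+c≡8
  with refl ← +≡⇒≡∸ a d a+d≡10 | refl ← +≡⇒≡∸ b c b+c≡8 =
  _ , B4-witness₁ a<10 (subst (_≤ a) (+-comm b 1) b+1≤a)

B4-family₂ : ∀ {a d} → a ≤ 8 → a + d ≡ 9 → B4 (decimal a 9 9 d)
B4-family₂ {a} {d} a≤8 a+d≡9 with refl ← +≡⇒≡∸ a d a+d≡9 = _ , B4-witness₂ (s≤s a≤8)

mainTheorem1 : (a b c d : ℕ) → a < 10 → b < 10 → c < 10 → d < 10 →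
    B4 (a * 1000 + b * 100 + c * 10 + d) ⇔
      ((a + d ≡ 10 × b + c ≡ 8 × b + 1 ≤ a)
       ⊎ (b ≡ 9 × c ≡ 9 × a + d ≡ 9 × a ≤ 8))
mainTheorem1 a b c d a<10 b<10 c<10 d<10 = mk⇔ image⇒digits digits⇒image
  where
  image⇒digits : B4 (decimal a b c d) → KaprekarDigits a b c d
  image⇒digits (m , a4 , Km≡n) = subst KaprekarDigitList
    (trans (cong digits4 Km≡n) (digits4-decimal a<10 b<10 c<10 d<10))
    (kaprekarDigits-K m a4)
  digits⇒image : KaprekarDigits a b c d → B4 (decimal a b c d)
  digits⇒image (inj₁ (a+d≡10 , b+c≡8 , b+1≤a)) = B4-family₁ a<10 b+1≤a a+d≡10 b+c≡8
  digits⇒image (inj₂ (refl , refl , a+d≡9 , a≤8)) = B4-family₂ a≤8 a+d≡9
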